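{- Let $q$ be an odd prime power. Let $B\subset\mathbb{F}_q^2$ be a Besicovitch set, and choose $b_i\in\mathbb{F}_q$ for each $i\in\mathbb{F}_q\cup\{\infty\}$ with $\ell(i,b_i)\subset B$. For $P\in\mathbb{F}_q^2$ let $m_P$ be the number of indices $i\in\mathbb{F}_q\cup\{\infty\}$ with $P\in\ell(i,b_i)$. Then \[ \sum_{P \in B} \frac{(m_P-1)(m_P-2)}{2} \geq \frac{q}{3}. \]
   Context: $\mathbb{F}_q$ is the finite field with $q$ elements. For $m,b\in\mathbb{F}_q$, $\ell(m,b)$ denotes the line $\{(x,y)\in\mathbb{F}_q^2 : y=mx+b\}$, and for $a\in\mathbb{F}_q$, $\ell(\infty,a)$ denotes the vertical line $\{(x,y): x=a\}$. A Besicovitch set in $\mathbb{F}_q^2$ is a set $B\subset\mathbb{F}_q^2$ such that for each $i\in\mathbb{F}_q\cup\{\infty\}$ there exists $b_i\in\mathbb{F}_q$ with $\ell(i,b_i)\subset B$. -}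

module Defs where

open import Level using (0ℓ)
open import Data.Nat as ℕ using (ℕ; zero; suc)
open import Data.Fin using (Fin)
open import Data.Fin.Properties using () renaming (_≟_ to _≟ᶠ_)
open import Data.Maybe using (Maybe; just; nothing)
open import Data.Product using (_×_; _,_; ∃)
open import Data.List using (List; []; _∷_; map; filter; length; concatMap; foldr)
open import Data.List.Base using (allFin)
open import Data.Bool using (Bool; true)
open import Data.Integer as ℤ using (ℤ; +_)
open import Data.Rational as ℚ using (ℚ)
open import Relation.Binary.PropositionalEquality using (_≡_; _≢_; cong; refl; sym; trans)
open import Relation.Nullary using (Dec; yes; no)
open import Relation.Unary using (Decidable)
open import Algebra.Structures using (IsCommutativeRing)
open import Function.Bundles using (_↔_; Inverse)

record FiniteField (q : ℕ) : Set₁ where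
  field
    Carrier : Set
    _+_ _*_ : Carrier → Carrier → Carrier
    -_ : Carrier → Carrier
    0# 1# : Carrier
    isCommutativeRing : IsCommutativeRing _≡_ _+_ _*_ -_ 0# 1#
    0≢1 : 0# ≢ 1#
    inverse : ∀ x → x ≢ 0# → ∃ λ y → x * y ≡ 1#
    enum : Carrier ↔ Fin q

  infixl 6 _+_
  infixl 7 _*_

  toFin : Carrier → Fin q
  toFin = Inverse.to enum

  fromFin : Fin q → Carrier
  fromFin = Inverse.from enum

  _≟_ : (x y : Carrier) → Dec (x ≡ y)
  x ≟ y with toFin x ≟ᶠ toFin y
  ... | yes e = yes (trans (sym (Inverse.inverseʳ enum refl)) (trans (cong fromFin e) (Inverse.inverseʳ enum refl)))
  ... | no ne = no (λ e → ne (cong toFin e))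

  elements : List Carrier
  elements = map fromFin (allFin q)

  Point : Set
  Point = Carrier × Carrier

  points : List Point
  points = concatMap (λ x → map (λ y → (x , y)) elements) elements

  -- slopes: just m is the slope m ∈ F_q, nothing is the slope ∞
  Slope : Set
  Slope = Maybe Carrier

  slopes : List Slope
  slopes = nothing ∷ map just elements

  _∈ℓ_ : Point → Slope × Carrier → Set
  (x , y) ∈ℓ (just m , b) = y ≡ m * x + b
  (x , y) ∈ℓ (nothing , a) = x ≡ a

  _∈ℓ?_ : (P : Point) (l : Slope × Carrier) → Dec (P ∈ℓ l)
  (x , y) ∈ℓ? (just m , b) = y ≟ (m * x + b)
  (x , y) ∈ℓ? (nothing , a) = x ≟ a

  Subset : Set
  Subset = Point → Bool

  _∈_ : Point → Subset → Set
  P ∈ B = B P ≡ true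

  LinesIn : Subset → (Slope → Carrier) → Set
  LinesIn B b = ∀ (i : Slope) (P : Point) → P ∈ℓ (i , b i) → P ∈ B

  IsBesicovitch : Subset → Set
  IsBesicovitch B = ∃ λ b → LinesIn B b

  mult : (Slope → Carrier) → Point → ℕ
  mult b P = length (filter (λ i → P ∈ℓ? (i , b i)) slopes)

  pointsOf : Subset → List Point
  pointsOf B = filter (λ P → Data.Bool._≟_ (B P) true) points

sumℚ : List ℚ → ℚ
sumℚ = foldr ℚ._+_ ℚ.0ℚ

-- (m-1)(m-2)/2 as a rational number (computed in ℤ, so m = 0 gives 1)
pairTerm : ℕ → ℚ
pairTerm m = ((+ m ℤ.- + 1) ℤ.* (+ m ℤ.- + 2)) ℚ./ 2

{-# OPTIONS --safe #-}
-- Call the chosen line ℓ(i, b_i) rich-free if none of its points lies on three of the chosen lines.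
-- Counting incidences between chosen lines and points with m_P ≥ 3 in two ways gives
-- Σ_{m_P ≥ 3} m_P ≥ #{i : ℓ(i, b_i) is not rich-free}, and (m - 1)(m - 2)/2 ≥ m/3 for m ≥ 3, so it
-- suffices that at most one of the q + 1 lines is rich-free.
-- Suppose ℓ_i and ℓ_j are both rich-free and meet at Z. Every other chosen line ℓ_k meets them at points
-- A_k ≠ Z and B_k ≠ Z, and distinct k give distinct A_k and distinct B_k. Measuring A_k and B_k from Z
-- along the two lines gives injections t, s of the q - 1 remaining slopes into F_q^*, and by similar
-- triangles t_k = ρ_k s_k, where ρ_k is a Möbius function of the slope k, again injective into F_q^*.
-- So all three are bijections onto F_q^*; taking products and using Wilson's theorem ∏ F_q^* = -1
-- gives -1 = (-1)(-1) = 1, impossible in odd characteristic.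
module Submission where

open import Level using (Level; 0ℓ)
open import Function.Base using (_∘_; id)
open import Function.Bundles using (Inverse; mk⇔)
open import Data.Empty using (⊥; ⊥-elim)
open import Data.Product using (_×_; _,_; proj₁; proj₂; swap)
open import Data.Sum using (_⊎_; inj₁; inj₂)
open import Data.Maybe using (Maybe; just; nothing)
import Data.Maybe.Properties as Maybe
open import Data.Bool as Bool using (Bool; true; false)
open import Data.Bool.Properties using (xor-∧-commutativeRing; not-involutive)
open import Data.Nat as ℕ using (ℕ; zero; suc; z≤n; s≤s)
import Data.Nat.Properties as ℕ
open import Data.Nat.Divisibility using (_∣_; divides)
open import Data.Integer as ℤ using (ℤ; 0ℤ; 1ℤ; -[1+_]; _⊖_; _◃_)
open import Data.Integer.Properties as ℤ using ([1+m]⊖[1+n]≡m⊖n; +◃n≡+n; -◃n≡-n)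
import Data.Sign as Sign
open import Data.List using (List; []; _∷_; map; filter; foldr; length; allFin)
open import Data.List.Properties using (filter-notAll; filter-none; length-map; length-tabulate; map-id; map-cong)
open import Data.List.Membership.Propositional using (_∈_; _∉_; lose)
open import Data.List.Membership.Propositional.Properties using (∈-filter⁺; ∈-filter⁻; ∈-map⁺; ∈-map⁻; ∈-allFin; ∈-concatMap⁺)
open import Data.List.Membership.Propositional.Properties.WithK using (unique∧set⇒bag)
open import Data.List.Relation.Unary.Any as Any using (here; there)
open import Data.List.Relation.Unary.All as All using (All; []; _∷_)
open import Data.List.Relation.Unary.All.Properties as All using (All¬⇒¬Any; ¬Any⇒All¬)
open import Data.List.Relation.Unary.Unique.Propositional using (Unique; []; _∷_)
import Data.List.Relation.Unary.Unique.Propositional.Properties as Unique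
open import Data.List.Relation.Binary.Subset.Propositional using (_⊆_)
open import Data.List.Relation.Binary.Permutation.Propositional using (_↭_; ↭⇒↭ₛ′)
open import Data.List.Relation.Binary.Permutation.Propositional.Properties using (↭-length; map⁺)
import Data.List.Relation.Binary.Permutation.Setoid.Properties as Permutationₛ
open import Data.List.Relation.Binary.BagAndSetEquality using (∼bag⇒↭)
open import Algebra.Bundles using (CommutativeMonoid; CommutativeRing)
open import Algebra.Structures using (IsCommutativeRing)
import Algebra.Properties.CommutativeSemigroup as CommutativeSemigroupProperties
open import Algebra.Solver.Ring.AlmostCommutativeRing using (fromCommutativeRing; _-Raw-AlmostCommutative⟶_)
open import Relation.Nullary using (¬_; Dec; yes; no; ¬?)
open import Relation.Nullary.Decidable using (decidable-stable)
open import Relation.Unary using (Decidable)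
open import Relation.Binary.Definitions using (DecidableEquality)
open import Relation.Binary.PropositionalEquality as ≡ using (_≡_; _≢_; refl; subst; module ≡-Reasoning)

open import Defs

private variable
  a b c ℓ : Level

Unique-map⁺-injectiveOn : {A : Set a} {B : Set b} {f : A → B} {xs : List A} → Unique xs →
              (∀ {x y} → x ∈ xs → y ∈ xs → f x ≡ f y → x ≡ y) → Unique (map f xs)
Unique-map⁺-injectiveOn [] _ = []
Unique-map⁺-injectiveOn {xs = x ∷ xs} (x∉xs ∷ u) injective =
  All.map⁺ (All.tabulate λ y∈xs fx≡fy →
    All¬⇒¬Any x∉xs (subst (_∈ xs) (≡.sym (injective (here refl) (there y∈xs) fx≡fy)) y∈xs))
  ∷ Unique-map⁺-injectiveOn u (λ x∈ y∈ → injective (there x∈) (there y∈))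

module UniqueLists {A : Set a} (_≟_ : DecidableEquality A) where
  open import Data.Nat using (_≤_; _<_)
  open import Data.List.Membership.DecPropositional _≟_ using (_∈?_)

  delete : A → List A → List A
  delete x = filter (λ y → ¬? (y ≟ x))

  ∈-delete⁺ : ∀ {x y xs} → y ∈ xs → y ≢ x → y ∈ delete x xs
  ∈-delete⁺ = ∈-filter⁺ _

  ∈-delete⁻ : ∀ {x y} xs → y ∈ delete x xs → y ∈ xs × y ≢ x
  ∈-delete⁻ xs = ∈-filter⁻ _ {xs = xs}

  Unique-delete : ∀ {x xs} → Unique xs → Unique (delete x xs)
  Unique-delete = Unique.filter⁺ _

  length-delete< : ∀ {x xs} → x ∈ xs → length (delete x xs) < length xs
  length-delete< {xs = xs} x∈xs = filter-notAll _ xs (Any.map (λ { refl ¬x≢x → ¬x≢x refl }) x∈xs)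

  ⊆⇒length-≤ : ∀ {xs ys : List A} → Unique xs → xs ⊆ ys → length xs ≤ length ys
  ⊆⇒length-≤ [] _ = z≤n
  ⊆⇒length-≤ {x ∷ xs} {ys} (x∉xs ∷ u) xs⊆ys =
    ℕ.≤-trans (s≤s (⊆⇒length-≤ u xs⊆ys-x)) (length-delete< (xs⊆ys (here refl)))
    where
    xs⊆ys-x : xs ⊆ delete x ys
    xs⊆ys-x z∈xs = ∈-delete⁺ (xs⊆ys (there z∈xs)) λ { refl → All¬⇒¬Any x∉xs z∈xs }

  ⊆∧length-≤⇒⊇ : ∀ {xs ys : List A} → Unique xs → xs ⊆ ys → length ys ≤ length xs → ys ⊆ xs
  ⊆∧length-≤⇒⊇ {xs} {ys} u xs⊆ys ∣ys∣≤∣xs∣ {y} y∈ys with y ∈? xs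
  ... | yes y∈xs = y∈xs
  ... | no y∉xs = ⊥-elim (ℕ.<⇒≱ ∣xs∣<∣ys∣ ∣ys∣≤∣xs∣)
    where
    ∣xs∣<∣ys∣ : length xs < length ys
    ∣xs∣<∣ys∣ = ⊆⇒length-≤ (¬Any⇒All¬ xs y∉xs ∷ u) λ { (here refl) → y∈ys ; (there z∈xs) → xs⊆ys z∈xs }

  ⊆∧⊇⇒↭ : ∀ {xs ys : List A} → Unique xs → Unique ys → xs ⊆ ys → ys ⊆ xs → xs ↭ ys
  ⊆∧⊇⇒↭ u v xs⊆ys ys⊆xs = ∼bag⇒↭ (unique∧set⇒bag u v λ {z} → mk⇔ (xs⊆ys {z}) (ys⊆xs {z}))

  ↭-delete : ∀ {x xs} → Unique xs → x ∈ xs → xs ↭ x ∷ delete x xs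
  ↭-delete {x} {xs} u x∈xs = ⊆∧⊇⇒↭ u (x∉ ∷ Unique-delete {x} u) ⊆-∷ λ
    { (here refl) → x∈xs
    ; (there z∈) → proj₁ (∈-delete⁻ xs z∈) }
    where
    x∉ : All (x ≢_) (delete x xs)
    x∉ = ¬Any⇒All¬ _ λ x∈ → proj₂ (∈-delete⁻ xs x∈) refl
    ⊆-∷ : xs ⊆ x ∷ delete x xs
    ⊆-∷ {z} z∈xs with z ≟ x
    ... | yes refl = here refl
    ... | no z≢x = there (∈-delete⁺ z∈xs z≢x)

  length-delete : ∀ {x xs} → Unique xs → x ∈ xs → length xs ≡ suc (length (delete x xs))
  length-delete u x∈xs = ↭-length (↭-delete u x∈xs)

  filter-delete-↭ : ∀ {P : A → Set ℓ} (P? : Decidable P) {x xs} → ¬ P x → Unique xs → filter P? (delete x xs) ↭ filter P? xs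
  filter-delete-↭ P? {x} {xs} ¬Px u = ⊆∧⊇⇒↭ (Unique.filter⁺ P? (Unique-delete {x} u)) (Unique.filter⁺ P? u)
    (λ z∈ → let z∈xs-x , Pz = ∈-filter⁻ P? {xs = delete x xs} z∈ in ∈-filter⁺ P? (proj₁ (∈-delete⁻ xs z∈xs-x)) Pz)
    (λ z∈ → let z∈xs , Pz = ∈-filter⁻ P? {xs = xs} z∈ in ∈-filter⁺ P? (∈-delete⁺ z∈xs λ { refl → ¬Px Pz }) Pz)

record InvolutionOn {A : Set a} (σ : A → A) (xs : List A) : Set a where
  field
    closed : ∀ {x} → x ∈ xs → σ x ∈ xs
    involutive : ∀ {x} → x ∈ xs → σ (σ x) ≡ x

fixed? : {A : Set a} → DecidableEquality A → (σ : A → A) → Decidable (λ x → σ x ≡ x)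
fixed? _≟_ σ x = σ x ≟ x

module InvolutionProperties {A : Set a} (_≟_ : DecidableEquality A) {σ : A → A} where
  open UniqueLists _≟_
  open InvolutionOn

  InvolutionOn-tail : ∀ {x xs} → Unique (x ∷ xs) → σ x ≡ x → InvolutionOn σ (x ∷ xs) → InvolutionOn σ xs
  InvolutionOn-tail {x} {xs} (x∉xs ∷ _) σx≡x inv = record
    { closed = closed-tail
    ; involutive = involutive inv ∘ there
    }
    where
    closed-tail : ∀ {y} → y ∈ xs → σ y ∈ xs
    closed-tail {y} y∈xs with closed inv (there y∈xs)
    ... | there σy∈xs = σy∈xs
    ... | here σy≡x = ⊥-elim (All¬⇒¬Any x∉xs (subst (_∈ xs) y≡x y∈xs))
      where
      y≡x : y ≡ x
      y≡x = ≡.trans (≡.sym (involutive inv (there y∈xs))) (≡.trans (≡.cong σ σy≡x) σx≡x)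

  InvolutionOn-delete : ∀ {x xs} → Unique (x ∷ xs) → InvolutionOn σ (x ∷ xs) → InvolutionOn σ (delete (σ x) xs)
  InvolutionOn-delete {x} {xs} (x∉xs ∷ _) inv = record
    { closed = closed-delete
    ; involutive = involutive inv ∘ there ∘ proj₁ ∘ ∈-delete⁻ xs
    }
    where
    closed-delete : ∀ {y} → y ∈ delete (σ x) xs → σ y ∈ delete (σ x) xs
    closed-delete {y} y∈ with ∈-delete⁻ xs y∈
    ... | y∈xs , y≢σx with closed inv (there y∈xs)
    ...   | here σy≡x = ⊥-elim (y≢σx (≡.trans (≡.sym (involutive inv (there y∈xs))) (≡.cong σ σy≡x)))
    ...   | there σy∈xs = ∈-delete⁺ σy∈xs λ σy≡σx → All¬⇒¬Any x∉xs (subst (_∈ xs) (y≡x σy≡σx) y∈xs)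
      where
      y≡x : σ y ≡ σ x → y ≡ x
      y≡x σy≡σx = ≡.trans (≡.sym (involutive inv (there y∈xs))) (≡.trans (≡.cong σ σy≡σx) (involutive inv (here refl)))

module Folds (M : CommutativeMonoid c ℓ) where
  open import Data.Nat using (_≤_)
  open CommutativeMonoid M renaming (refl to ≈-refl; sym to ≈-sym; trans to ≈-trans)
  open CommutativeSemigroupProperties commutativeSemigroup using (interchange)
  open import Relation.Binary.Reasoning.Setoid setoid

  foldMap : {A : Set a} → (A → Carrier) → List A → Carrier
  foldMap w xs = foldr _∙_ ε (map w xs)

  module _ {A : Set a} where

    foldMap-↭ : (w : A → Carrier) {xs ys : List A} → xs ↭ ys → foldMap w xs ≈ foldMap w ys
    foldMap-↭ w p = Permutationₛ.foldr-commMonoid setoid isCommutativeMonoid (↭⇒↭ₛ′ isEquivalence (map⁺ w p))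

    foldMap-∙ : (f g h : A → Carrier) (xs : List A) → (∀ {x} → x ∈ xs → f x ≈ g x ∙ h x) →
                foldMap f xs ≈ foldMap g xs ∙ foldMap h xs
    foldMap-∙ f g h [] _ = ≈-sym (identityˡ ε)
    foldMap-∙ f g h (x ∷ xs) f≈g∙h = begin
      f x ∙ foldMap f xs                           ≈⟨ ∙-cong (f≈g∙h (here refl)) (foldMap-∙ f g h xs (f≈g∙h ∘ there)) ⟩
      (g x ∙ h x) ∙ (foldMap g xs ∙ foldMap h xs)  ≈⟨ interchange _ _ _ _ ⟩
      (g x ∙ foldMap g xs) ∙ (h x ∙ foldMap h xs)  ∎

    foldMap-ε : (xs : List A) → foldMap (λ _ → ε) xs ≈ ε
    foldMap-ε [] = ≈-refl
    foldMap-ε (x ∷ xs) = ≈-trans (identityˡ _) (foldMap-ε xs)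

  foldMap-swap : {A : Set a} {B : Set b} (χ : A → B → Carrier) (xs : List A) (ys : List B) →
                 foldMap (λ x → foldMap (χ x) ys) xs ≈ foldMap (λ y → foldMap (λ x → χ x y) xs) ys
  foldMap-swap χ [] ys = ≈-sym (foldMap-ε ys)
  foldMap-swap χ (x ∷ xs) ys = begin
    foldMap (χ x) ys ∙ foldMap (λ x → foldMap (χ x) ys) xs            ≈⟨ ∙-congˡ (foldMap-swap χ xs ys) ⟩
    foldMap (χ x) ys ∙ foldMap (λ y → foldMap (λ x → χ x y) xs) ys    ≈⟨ foldMap-∙ _ (χ x) _ ys (λ _ → ≈-refl) ⟨
    foldMap (λ y → χ x y ∙ foldMap (λ x → χ x y) xs) ys               ∎

  module _ {A : Set a} (_≟_ : DecidableEquality A) (w : A → Carrier) {σ : A → A} where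
    open UniqueLists _≟_
    open InvolutionProperties _≟_
    open InvolutionOn

    foldMap-involution : ∀ {xs} → Unique xs → InvolutionOn σ xs → (∀ {x} → x ∈ xs → σ x ≢ x → w x ∙ w (σ x) ≈ ε) →
                         foldMap w xs ≈ foldMap w (filter (fixed? _≟_ σ) xs)
    foldMap-involution {xs} = go (length xs) ℕ.≤-refl
      where
      go : ∀ n {xs} → length xs ≤ n → Unique xs → InvolutionOn σ xs → (∀ {x} → x ∈ xs → σ x ≢ x → w x ∙ w (σ x) ≈ ε) →
           foldMap w xs ≈ foldMap w (filter (fixed? _≟_ σ) xs)
      go _ {[]} _ _ _ _ = ≈-refl
      go (suc n) {x ∷ xs} (s≤s ∣xs∣≤n) u@(x∉xs ∷ xs-unique) inv cancel with fixed? _≟_ σ x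
      ... | yes σx≡x = ∙-congˡ (go n ∣xs∣≤n xs-unique (InvolutionOn-tail u σx≡x inv) (cancel ∘ there))
      ... | no σx≢x = begin
        w x ∙ foldMap w xs                      ≈⟨ ∙-congˡ (foldMap-↭ w (↭-delete xs-unique σx∈xs)) ⟩
        w x ∙ (w (σ x) ∙ foldMap w rest)        ≈⟨ assoc _ _ _ ⟨
        (w x ∙ w (σ x)) ∙ foldMap w rest        ≈⟨ ∙-congʳ (cancel (here refl) σx≢x) ⟩
        ε ∙ foldMap w rest                      ≈⟨ identityˡ _ ⟩
        foldMap w rest                          ≈⟨ go n ∣rest∣≤n (Unique-delete {σ x} xs-unique) (InvolutionOn-delete u inv)
                                                      (λ y∈ → cancel (there (proj₁ (∈-delete⁻ xs y∈)))) ⟩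
        foldMap w (filter (fixed? _≟_ σ) rest)  ≈⟨ foldMap-↭ w (filter-delete-↭ (fixed? _≟_ σ) σσx≢σx xs-unique) ⟩
        foldMap w (filter (fixed? _≟_ σ) xs)    ∎
        where
        rest = delete (σ x) xs
        σx∈xs : σ x ∈ xs
        σx∈xs with closed inv (here refl)
        ... | here σx≡x = ⊥-elim (σx≢x σx≡x)
        ... | there σx∈xs = σx∈xs
        ∣rest∣≤n : length rest ≤ n
        ∣rest∣≤n = ℕ.≤-trans (ℕ.<⇒≤ (length-delete< σx∈xs)) ∣xs∣≤n
        σσx≢σx : σ (σ x) ≢ σ x
        σσx≢σx σσx≡σx = σx≢x (≡.trans (≡.sym σσx≡σx) (involutive inv (here refl)))

-- In (Bool, xor) the fold of the constant true is the parity of the length.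
module _ {A : Set a} (_≟_ : DecidableEquality A) where
  open Folds (CommutativeRing.+-commutativeMonoid xor-∧-commutativeRing)

  private
    parity-even : (xs : List A) → foldMap (λ _ → true) xs ≡ false → 2 ∣ length xs
    parity-even [] _ = divides 0 refl
    parity-even (_ ∷ []) ()
    parity-even (_ ∷ _ ∷ xs) even with divides k ∣xs∣≡k*2 ← parity-even xs (≡.trans (≡.sym (not-involutive _)) even) =
      divides (suc k) (≡.cong (suc ∘ suc) ∣xs∣≡k*2)

  fixed-point-free⇒even : {σ : A → A} {xs : List A} → Unique xs → InvolutionOn σ xs → (∀ {x} → x ∈ xs → σ x ≢ x) →
                             2 ∣ length xs
  fixed-point-free⇒even {σ} {xs} u inv no-fixed = parity-even xs (≡.trans
    (foldMap-involution _≟_ (λ _ → true) u inv (λ _ _ → refl))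
    (≡.cong (foldMap (λ _ → true)) (filter-none (fixed? _≟_ σ) (All.tabulate no-fixed))))

module Sums where
  open import Data.Nat using (_≤_)
  open Folds ℕ.+-0-commutativeMonoid public using (foldMap-swap) renaming (foldMap to ∑)

  indicator : {A : Set a} → Dec A → ℕ
  indicator (yes _) = 1
  indicator (no _) = 0

  module _ {A : Set a} where

    ∑-indicator : {P : A → Set ℓ} (P? : Decidable P) (xs : List A) → ∑ (indicator ∘ P?) xs ≡ length (filter P? xs)
    ∑-indicator P? [] = refl
    ∑-indicator P? (x ∷ xs) with P? x
    ... | yes _ = ≡.cong suc (∑-indicator P? xs)
    ... | no _ = ∑-indicator P? xs

    ∑-*ˡ : (c : ℕ) (f : A → ℕ) (xs : List A) → ∑ (λ x → c ℕ.* f x) xs ≡ c ℕ.* ∑ f xs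
    ∑-*ˡ c f [] = ≡.sym (ℕ.*-zeroʳ c)
    ∑-*ˡ c f (x ∷ xs) = ≡.trans (≡.cong (c ℕ.* f x ℕ.+_) (∑-*ˡ c f xs)) (≡.sym (ℕ.*-distribˡ-+ c (f x) (∑ f xs)))

    ∑-filter : {P : A → Set ℓ} (P? : Decidable P) {f : A → ℕ} → (∀ {x} → ¬ P x → f x ≡ 0) →
               (xs : List A) → ∑ f (filter P? xs) ≡ ∑ f xs
    ∑-filter P? f-vanishes [] = refl
    ∑-filter P? {f} f-vanishes (x ∷ xs) with P? x
    ... | yes _ = ≡.cong (f x ℕ.+_) (∑-filter P? f-vanishes xs)
    ... | no ¬Px = ≡.trans (∑-filter P? f-vanishes xs) (≡.cong (ℕ._+ ∑ f xs) (≡.sym (f-vanishes ¬Px)))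

    term≤∑ : (f : A → ℕ) {x : A} {xs : List A} → x ∈ xs → f x ≤ ∑ f xs
    term≤∑ f {xs = y ∷ ys} (here refl) = ℕ.m≤m+n (f y) (∑ f ys)
    term≤∑ f {xs = y ∷ ys} (there x∈ys) = ℕ.≤-trans (term≤∑ f x∈ys) (ℕ.m≤n+m (∑ f ys) (f y))

    length≤∑ : (f : A → ℕ) (xs : List A) → (∀ {x} → x ∈ xs → f x ≢ 0) → length xs ≤ ∑ f xs
    length≤∑ f [] _ = z≤n
    length≤∑ f (x ∷ xs) nonzero = ℕ.+-mono-≤ (ℕ.n≢0⇒n>0 (nonzero (here refl))) (length≤∑ f xs (nonzero ∘ there))

    length≤1+∑ : (f : A → ℕ) {xs : List A} → Unique xs → (∀ {x y} → x ∈ xs → y ∈ xs → f x ≡ 0 → f y ≡ 0 → x ≡ y) →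
                 length xs ≤ suc (∑ f xs)
    length≤1+∑ f [] _ = z≤n
    length≤1+∑ f {x ∷ xs} (x∉xs ∷ u) one-zero with f x in fx≡
    ... | zero = s≤s (length≤∑ f xs λ {y} y∈xs fy≡0 →
                   All¬⇒¬Any x∉xs (subst (_∈ xs) (≡.sym (one-zero (here refl) (there y∈xs) fx≡ fy≡0)) y∈xs))
    ... | suc n = s≤s (ℕ.≤-trans (length≤1+∑ f u λ x∈ y∈ → one-zero (there x∈) (there y∈))
                                 (s≤s (ℕ.m≤n+m (∑ f xs) n)))

richWeight : ℕ → ℕ
richWeight m = Sums.indicator (3 ℕ.≤? m) ℕ.* m

-- The ring solver normalises coefficients by evaluation, so it needs a concrete coefficient ring;
-- ℤ maps into every commutative ring.
module IntegerCoefficients (R : CommutativeRing c ℓ) where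
  open CommutativeRing R renaming (refl to ≈-refl; sym to ≈-sym; trans to ≈-trans)
  open import Algebra.Properties.Ring ring using (-‿distribˡ-*; -‿distribʳ-*; -‿involutive; -0#≈0#; -‿+-comm)
  open import Algebra.Properties.Semiring.Mult.TCOptimised semiring using (×-homo-+; ×1-homo-*; 1+×) renaming (_×_ to _·_)
  open CommutativeSemigroupProperties +-commutativeSemigroup using (interchange)
  open import Relation.Binary.Reasoning.Setoid setoid

  ⟦_⟧ : ℤ → Carrier
  ⟦ ℤ.+ n ⟧ = n · 1#
  ⟦ -[1+ n ] ⟧ = - (suc n · 1#)

  private
    x-0≈x : ∀ x → x - 0# ≈ x
    x-0≈x x = ≈-trans (+-congˡ -0#≈0#) (+-identityʳ x)

    ⊖-homo : ∀ m n → ⟦ m ⊖ n ⟧ ≈ m · 1# - n · 1#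
    ⊖-homo zero zero = ≈-sym (x-0≈x 0#)
    ⊖-homo (suc m) zero = ≈-sym (x-0≈x _)
    ⊖-homo zero (suc n) = ≈-sym (+-identityˡ _)
    ⊖-homo (suc m) (suc n) = begin
      ⟦ suc m ⊖ suc n ⟧                         ≡⟨ ≡.cong ⟦_⟧ ([1+m]⊖[1+n]≡m⊖n m n) ⟩
      ⟦ m ⊖ n ⟧                                 ≈⟨ ⊖-homo m n ⟩
      m · 1# - n · 1#                           ≈⟨ +-identityˡ _ ⟨
      0# + (m · 1# - n · 1#)                    ≈⟨ +-congʳ (-‿inverseʳ 1#) ⟨
      (1# - 1#) + (m · 1# - n · 1#)             ≈⟨ interchange _ _ _ _ ⟩
      (1# + m · 1#) + (- 1# + - (n · 1#))       ≈⟨ +-congˡ (-‿+-comm _ _) ⟩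
      (1# + m · 1#) - (1# + n · 1#)             ≈⟨ +-cong (1+× m 1#) (-‿cong (1+× n 1#)) ⟨
      suc m · 1# - suc n · 1#                   ∎

    +-homo : ∀ i j → ⟦ i ℤ.+ j ⟧ ≈ ⟦ i ⟧ + ⟦ j ⟧
    +-homo (ℤ.+ m) (ℤ.+ n) = ×-homo-+ 1# m n
    +-homo (ℤ.+ m) -[1+ n ] = ⊖-homo m (suc n)
    +-homo -[1+ m ] (ℤ.+ n) = ≈-trans (⊖-homo n (suc m)) (+-comm _ _)
    +-homo -[1+ m ] -[1+ n ] = begin
      - (suc (suc (m ℕ.+ n)) · 1#)              ≡⟨ ≡.cong (λ k → - (suc k · 1#)) (ℕ.+-suc m n) ⟨
      - ((suc m ℕ.+ suc n) · 1#)                ≈⟨ -‿cong (×-homo-+ 1# (suc m) (suc n)) ⟩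
      - (suc m · 1# + suc n · 1#)               ≈⟨ -‿+-comm _ _ ⟨
      - (suc m · 1#) + - (suc n · 1#)           ∎

    -‿homo : ∀ i → ⟦ ℤ.- i ⟧ ≈ - ⟦ i ⟧
    -‿homo (ℤ.+ zero) = ≈-sym -0#≈0#
    -‿homo (ℤ.+ suc n) = ≈-refl
    -‿homo -[1+ n ] = ≈-sym (-‿involutive _)

    -◃-homo : ∀ n → ⟦ Sign.- ◃ n ⟧ ≈ - (n · 1#)
    -◃-homo n = ≈-trans (reflexive (≡.cong ⟦_⟧ (-◃n≡-n n))) (-‿homo (ℤ.+ n))

    *-homo : ∀ i j → ⟦ i ℤ.* j ⟧ ≈ ⟦ i ⟧ * ⟦ j ⟧
    *-homo (ℤ.+ m) (ℤ.+ n) = ≈-trans (reflexive (≡.cong ⟦_⟧ (+◃n≡+n (m ℕ.* n)))) (×1-homo-* m n)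
    *-homo (ℤ.+ m) -[1+ n ] = ≈-trans (-◃-homo (m ℕ.* suc n)) (≈-trans (-‿cong (×1-homo-* m (suc n))) (-‿distribʳ-* _ _))
    *-homo -[1+ m ] (ℤ.+ n) = ≈-trans (-◃-homo (suc m ℕ.* n)) (≈-trans (-‿cong (×1-homo-* (suc m) n)) (-‿distribˡ-* _ _))
    *-homo -[1+ m ] -[1+ n ] = begin
      ⟦ Sign.+ ◃ (suc m ℕ.* suc n) ⟧            ≡⟨ ≡.cong ⟦_⟧ (+◃n≡+n (suc m ℕ.* suc n)) ⟩
      (suc m ℕ.* suc n) · 1#                    ≈⟨ ×1-homo-* (suc m) (suc n) ⟩
      (suc m · 1#) * (suc n · 1#)               ≈⟨ -‿involutive _ ⟨
      - - ((suc m · 1#) * (suc n · 1#))         ≈⟨ -‿cong (-‿distribˡ-* _ _) ⟩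
      - (- (suc m · 1#) * (suc n · 1#))         ≈⟨ -‿distribʳ-* _ _ ⟩
      - (suc m · 1#) * - (suc n · 1#)           ∎

    homomorphism : CommutativeRing.rawRing ℤ.+-*-commutativeRing -Raw-AlmostCommutative⟶ fromCommutativeRing R
    homomorphism = record
      { ⟦_⟧ = ⟦_⟧ ; +-homo = +-homo ; *-homo = *-homo ; -‿homo = -‿homo ; 0-homo = ≈-refl ; 1-homo = ≈-refl }

    ⟦⟧-≟ : ∀ i j → Maybe (⟦ i ⟧ ≈ ⟦ j ⟧)
    ⟦⟧-≟ i j with i ℤ.≟ j
    ... | yes i≡j = just (reflexive (≡.cong ⟦_⟧ i≡j))
    ... | no _ = nothing

  open import Algebra.Solver.Ring (CommutativeRing.rawRing ℤ.+-*-commutativeRing) (fromCommutativeRing R) homomorphism ⟦⟧-≟ public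
    using (solve; _:+_; _:*_; _:-_; :-_; con; _:=_)

module FieldProperties {q : ℕ} (F : FiniteField q) where
  open FiniteField F hiding (_∈_)
  open IsCommutativeRing isCommutativeRing using (*-assoc; *-comm; *-identityˡ; zeroʳ)

  ring : CommutativeRing 0ℓ 0ℓ
  ring = record { isCommutativeRing = isCommutativeRing }

  open CommutativeRing ring public using (_-_)
  open ≡-Reasoning
  open IntegerCoefficients ring public using (solve; _:+_; _:*_; _:-_; :-_; con; _:=_)

  x-x≡0 : ∀ x → x - x ≡ 0#
  x-x≡0 = solve 1 (λ x → x :- x := con 0ℤ) refl

  x-z≡y-z⇒x≡y : ∀ {x y z} → x - z ≡ y - z → x ≡ y
  x-z≡y-z⇒x≡y {x} {y} {z} x-z≡y-z = begin
    x                ≡⟨ solve 2 (λ x z → x := (x :- z) :+ z) refl x z ⟩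
    (x - z) + z      ≡⟨ ≡.cong (_+ z) x-z≡y-z ⟩
    (y - z) + z      ≡⟨ solve 2 (λ y z → (y :- z) :+ z := y) refl y z ⟩
    y                ∎

  z-x≡z-y⇒x≡y : ∀ {x y z} → z - x ≡ z - y → x ≡ y
  z-x≡z-y⇒x≡y {x} {y} {z} z-x≡z-y = begin
    x                ≡⟨ solve 2 (λ x z → x := z :- (z :- x)) refl x z ⟩
    z - (z - x)      ≡⟨ ≡.cong (λ w → z - w) z-x≡z-y ⟩
    z - (z - y)      ≡⟨ solve 2 (λ y z → z :- (z :- y) := y) refl y z ⟩
    y                ∎

  x-y≡0⇒x≡y : ∀ {x y} → x - y ≡ 0# → x ≡ y
  x-y≡0⇒x≡y {x} {y} x-y≡0 = x-z≡y-z⇒x≡y (≡.trans x-y≡0 (≡.sym (x-x≡0 y)))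

  x≢y⇒x-y≢0 : ∀ {x y} → x ≢ y → x - y ≢ 0#
  x≢y⇒x-y≢0 x≢y = x≢y ∘ x-y≡0⇒x≡y

  1≢0 : 1# ≢ 0#
  1≢0 = 0≢1 ∘ ≡.sym

  -1≢0 : - 1# ≢ 0#
  -1≢0 -1≡0 = 1≢0 (begin
    1#        ≡⟨ solve 0 (con 1ℤ := :- (:- con 1ℤ)) refl ⟩
    - - 1#    ≡⟨ ≡.cong -_ -1≡0 ⟩
    - 0#      ≡⟨ solve 0 (:- con 0ℤ := con 0ℤ) refl ⟩
    0#        ∎)

  -- 0 ⁻¹ = 0 is junk.
  _⁻¹ : Carrier → Carrier
  x ⁻¹ with x ≟ 0#
  ... | yes _ = 0#
  ... | no x≢0 = proj₁ (inverse x x≢0)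

  ⁻¹-inverseʳ : ∀ {x} → x ≢ 0# → x * x ⁻¹ ≡ 1#
  ⁻¹-inverseʳ {x} x≢0 with x ≟ 0#
  ... | yes x≡0 = ⊥-elim (x≢0 x≡0)
  ... | no x≢0 = proj₂ (inverse x x≢0)

  ⁻¹-inverseˡ : ∀ {x} → x ≢ 0# → x ⁻¹ * x ≡ 1#
  ⁻¹-inverseˡ x≢0 = ≡.trans (*-comm _ _) (⁻¹-inverseʳ x≢0)

  ⁻¹-cancelˡ : ∀ {a} x → a ≢ 0# → a ⁻¹ * (a * x) ≡ x
  ⁻¹-cancelˡ {a} x a≢0 = begin
    a ⁻¹ * (a * x)  ≡⟨ *-assoc _ _ _ ⟨
    a ⁻¹ * a * x    ≡⟨ ≡.cong (_* x) (⁻¹-inverseˡ a≢0) ⟩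
    1# * x          ≡⟨ *-identityˡ x ⟩
    x               ∎

  ⁻¹-cancelʳ : ∀ {a} x → a ≢ 0# → a * (x * a ⁻¹) ≡ x
  ⁻¹-cancelʳ {a} x a≢0 = begin
    a * (x * a ⁻¹)  ≡⟨ solve 3 (λ a x b → a :* (x :* b) := x :* (a :* b)) refl a x (a ⁻¹) ⟩
    x * (a * a ⁻¹)  ≡⟨ ≡.cong (x *_) (⁻¹-inverseʳ a≢0) ⟩
    x * 1#          ≡⟨ solve 1 (λ x → x :* con 1ℤ := x) refl x ⟩
    x               ∎

  *-cancelˡ : ∀ {a x y} → a ≢ 0# → a * x ≡ a * y → x ≡ y
  *-cancelˡ {a} {x} {y} a≢0 ax≡ay = begin
    x               ≡⟨ ⁻¹-cancelˡ x a≢0 ⟨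
    a ⁻¹ * (a * x)  ≡⟨ ≡.cong (a ⁻¹ *_) ax≡ay ⟩
    a ⁻¹ * (a * y)  ≡⟨ ⁻¹-cancelˡ y a≢0 ⟩
    y               ∎

  xy≡0⇒y≡0 : ∀ {x y} → x ≢ 0# → x * y ≡ 0# → y ≡ 0#
  xy≡0⇒y≡0 {x} x≢0 xy≡0 = *-cancelˡ x≢0 (≡.trans xy≡0 (≡.sym (zeroʳ x)))

  *-≢0 : ∀ {x y} → x ≢ 0# → y ≢ 0# → x * y ≢ 0#
  *-≢0 x≢0 y≢0 = y≢0 ∘ xy≡0⇒y≡0 x≢0

  ux≡vy⇒x≡vu⁻¹y : ∀ {u v x y} → u ≢ 0# → u * x ≡ v * y → x ≡ (v * u ⁻¹) * y
  ux≡vy⇒x≡vu⁻¹y {u} {v} {x} {y} u≢0 ux≡vy = begin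
    x                  ≡⟨ ⁻¹-cancelˡ x u≢0 ⟨
    u ⁻¹ * (u * x)     ≡⟨ ≡.cong (u ⁻¹ *_) ux≡vy ⟩
    u ⁻¹ * (v * y)     ≡⟨ solve 3 (λ w v y → w :* (v :* y) := (v :* w) :* y) refl (u ⁻¹) v y ⟩
    (v * u ⁻¹) * y     ∎

  cross-multiply : ∀ {u v x y} → u ≢ 0# → v ≢ 0# → x * u ⁻¹ ≡ y * v ⁻¹ → x * v ≡ y * u
  cross-multiply {u} {v} {x} {y} u≢0 v≢0 x/u≡y/v = begin
    x * v                    ≡⟨ ≡.cong (_* v) (⁻¹-cancelʳ x u≢0) ⟨
    u * (x * u ⁻¹) * v       ≡⟨ ≡.cong (λ z → u * z * v) x/u≡y/v ⟩
    u * (y * v ⁻¹) * v       ≡⟨ solve 4 (λ u y w v → u :* (y :* w) :* v := v :* (y :* w) :* u) refl u y (v ⁻¹) v ⟩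
    v * (y * v ⁻¹) * u       ≡⟨ ≡.cong (_* u) (⁻¹-cancelʳ y v≢0) ⟩
    y * u                    ∎

  ⁻¹-≢0 : ∀ {x} → x ≢ 0# → x ⁻¹ ≢ 0#
  ⁻¹-≢0 {x} x≢0 x⁻¹≡0 = 0≢1 (begin
    0#          ≡⟨ zeroʳ x ⟨
    x * 0#      ≡⟨ ≡.cong (x *_) x⁻¹≡0 ⟨
    x * x ⁻¹    ≡⟨ ⁻¹-inverseʳ x≢0 ⟩
    1#          ∎)

  ⁻¹-unique : ∀ {x y} → x ≢ 0# → x * y ≡ 1# → x ⁻¹ ≡ y
  ⁻¹-unique x≢0 xy≡1 = *-cancelˡ x≢0 (≡.trans (⁻¹-inverseʳ x≢0) (≡.sym xy≡1))

  ⁻¹-involutive : ∀ {x} → x ≢ 0# → x ⁻¹ ⁻¹ ≡ x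
  ⁻¹-involutive x≢0 = ⁻¹-unique (⁻¹-≢0 x≢0) (⁻¹-inverseˡ x≢0)

  möbius : Carrier → Carrier → Carrier → Carrier
  möbius α β κ = (β - κ) * (α - κ) ⁻¹

  möbius≢1 : ∀ {α β κ} → α ≢ β → α ≢ κ → möbius α β κ ≢ 1#
  möbius≢1 {α} {β} {κ} α≢β α≢κ möbius≡1 = α≢β (x-z≡y-z⇒x≡y (begin
    α - κ                            ≡⟨ solve 1 (λ x → x := x :* con 1ℤ) refl (α - κ) ⟩
    (α - κ) * 1#                     ≡⟨ ≡.cong ((α - κ) *_) möbius≡1 ⟨
    (α - κ) * ((β - κ) * (α - κ) ⁻¹) ≡⟨ ⁻¹-cancelʳ (β - κ) (x≢y⇒x-y≢0 α≢κ) ⟩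
    β - κ                            ∎))

  möbius-injective : ∀ {α β κ μ} → α ≢ β → α ≢ κ → α ≢ μ → möbius α β κ ≡ möbius α β μ → κ ≡ μ
  möbius-injective {α} {β} {κ} {μ} α≢β α≢κ α≢μ möbius≡ = ≡.sym (x-y≡0⇒x≡y (xy≡0⇒y≡0 (x≢y⇒x-y≢0 α≢β) (begin
    (α - β) * (μ - κ)                      ≡⟨ solve 4 (λ α β κ μ → (α :- β) :* (μ :- κ)
                                                 := (β :- κ) :* (α :- μ) :- (β :- μ) :* (α :- κ)) refl α β κ μ ⟩
    (β - κ) * (α - μ) - (β - μ) * (α - κ)  ≡⟨ ≡.cong (_- (β - μ) * (α - κ))
                                                 (cross-multiply (x≢y⇒x-y≢0 α≢κ) (x≢y⇒x-y≢0 α≢μ) möbius≡) ⟩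
    (β - μ) * (α - κ) - (β - μ) * (α - κ)  ≡⟨ x-x≡0 _ ⟩
    0#                                     ∎)))

  möbius≢0 : ∀ {α β κ} → α ≢ κ → β ≢ κ → möbius α β κ ≢ 0#
  möbius≢0 α≢κ β≢κ = *-≢0 (x≢y⇒x-y≢0 β≢κ) (⁻¹-≢0 (x≢y⇒x-y≢0 α≢κ))

  x²≡1⇒x≡±1 : ∀ {x} → x * x ≡ 1# → x ≡ 1# ⊎ x ≡ - 1#
  x²≡1⇒x≡±1 {x} x²≡1 with (x - 1#) ≟ 0#
  ... | yes x-1≡0 = inj₁ (x-y≡0⇒x≡y x-1≡0)
  ... | no x-1≢0 = inj₂ (x-y≡0⇒x≡y (≡.trans (solve 1 (λ x → x :- (:- con 1ℤ) := x :+ con 1ℤ) refl x)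
                                             (*-cancelˡ x-1≢0 (≡.trans [x-1][x+1]≡0 (≡.sym (zeroʳ _))))))
    where
    [x-1][x+1]≡0 : (x - 1#) * (x + 1#) ≡ 0#
    [x-1][x+1]≡0 = begin
      (x - 1#) * (x + 1#)  ≡⟨ solve 1 (λ x → (x :- con 1ℤ) :* (x :+ con 1ℤ) := x :* x :- con 1ℤ) refl x ⟩
      x * x - 1#           ≡⟨ ≡.cong (_- 1#) x²≡1 ⟩
      1# - 1#              ≡⟨ x-x≡0 1# ⟩
      0#                   ∎

module Units {q : ℕ} (F : FiniteField q) where
  open import Data.Nat using (_≤_)
  open FiniteField F hiding (_∈_)
  open IsCommutativeRing isCommutativeRing using (+-assoc; +-identityʳ)
  open FieldProperties F
  open Folds (CommutativeRing.*-commutativeMonoid ring) public using () renaming (foldMap to ∏)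
  open Folds (CommutativeRing.*-commutativeMonoid ring) using (foldMap-↭; foldMap-∙; foldMap-involution)
  open UniqueLists _≟_
  open ≡-Reasoning

  ∈-elements : ∀ x → x ∈ elements
  ∈-elements x = subst (_∈ elements) (Inverse.strictlyInverseʳ enum x) (∈-map⁺ fromFin (∈-allFin (toFin x)))

  elements-unique : Unique elements
  elements-unique = Unique.map⁺ fromFin-injective (Unique.allFin⁺ q)
    where
    fromFin-injective : ∀ {i j} → fromFin i ≡ fromFin j → i ≡ j
    fromFin-injective {i} {j} e =
      ≡.trans (≡.sym (Inverse.strictlyInverseˡ enum i)) (≡.trans (≡.cong toFin e) (Inverse.strictlyInverseˡ enum j))

  length-elements : length elements ≡ q
  length-elements = ≡.trans (length-map fromFin (allFin q)) (length-tabulate id)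

  nonzeros : List Carrier
  nonzeros = delete 0# elements

  ∈-nonzeros : ∀ {x} → x ≢ 0# → x ∈ nonzeros
  ∈-nonzeros {x} = ∈-delete⁺ (∈-elements x)

  nonzeros-unique : Unique nonzeros
  nonzeros-unique = Unique-delete {0#} elements-unique

  length-nonzeros : suc (length nonzeros) ≡ q
  length-nonzeros = ≡.trans (≡.sym (length-delete elements-unique (∈-elements 0#))) length-elements

  1+1≢0 : ¬ 2 ∣ q → 1# + 1# ≢ 0#
  1+1≢0 q-odd 1+1≡0 = q-odd (subst (2 ∣_) length-elements
    (fixed-point-free⇒even _≟_ elements-unique +1-involution λ {x} _ → +1-no-fixed-point x))
    where
    +1-involution : InvolutionOn (_+ 1#) elements
    +1-involution = record
      { closed = λ {x} _ → ∈-elements (x + 1#)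
      ; involutive = λ {x} _ → begin
          x + 1# + 1#      ≡⟨ +-assoc x 1# 1# ⟩
          x + (1# + 1#)    ≡⟨ ≡.cong (x +_) 1+1≡0 ⟩
          x + 0#           ≡⟨ +-identityʳ x ⟩
          x                ∎
      }
    +1-no-fixed-point : ∀ x → x + 1# ≢ x
    +1-no-fixed-point x x+1≡x = 1≢0 (begin
      1#             ≡⟨ solve 2 (λ x o → o := (x :+ o) :- x) refl x 1# ⟩
      (x + 1#) - x   ≡⟨ ≡.cong (_- x) x+1≡x ⟩
      x - x          ≡⟨ x-x≡0 x ⟩
      0#             ∎)

  wilson : 1# + 1# ≢ 0# → ∏ id nonzeros ≡ - 1#
  wilson 1+1≢0 = begin
    ∏ id nonzeros                          ≡⟨ foldMap-involution _≟_ id nonzeros-unique ⁻¹-involution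
                                                (λ x∈ _ → ⁻¹-inverseʳ (nonzero x∈)) ⟩
    ∏ id (filter (fixed? _≟_ _⁻¹) nonzeros) ≡⟨ foldMap-↭ id self-inverses↭±1 ⟩
    ∏ id (1# ∷ - 1# ∷ [])                  ≡⟨ solve 0 (con 1ℤ :* ((:- con 1ℤ) :* con 1ℤ) := :- con 1ℤ) refl ⟩
    - 1#                                   ∎
    where
    nonzero : ∀ {x} → x ∈ nonzeros → x ≢ 0#
    nonzero = proj₂ ∘ ∈-delete⁻ elements
    ⁻¹-involution : InvolutionOn _⁻¹ nonzeros
    ⁻¹-involution = record
      { closed = λ x∈ → ∈-nonzeros (⁻¹-≢0 (nonzero x∈))
      ; involutive = λ x∈ → ⁻¹-involutive (nonzero x∈)
      }
    1≢-1 : 1# ≢ - 1#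
    1≢-1 1≡-1 = 1+1≢0 (≡.trans (≡.cong (1# +_) 1≡-1) (x-x≡0 1#))
    self-inverses↭±1 : filter (fixed? _≟_ _⁻¹) nonzeros ↭ 1# ∷ - 1# ∷ []
    self-inverses↭±1 = ⊆∧⊇⇒↭ (Unique.filter⁺ _ nonzeros-unique) ((1≢-1 ∷ []) ∷ [] ∷ []) self-inverse⇒±1 ±1-self-inverse
      where
      self-inverse⇒±1 : filter (fixed? _≟_ _⁻¹) nonzeros ⊆ 1# ∷ - 1# ∷ []
      self-inverse⇒±1 {x} x∈ with ∈-filter⁻ (fixed? _≟_ _⁻¹) {xs = nonzeros} x∈
      ... | x∈nonzeros , x⁻¹≡x
          with x²≡1⇒x≡±1 (≡.trans (≡.cong (x *_) (≡.sym x⁻¹≡x)) (⁻¹-inverseʳ (nonzero x∈nonzeros)))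
      ...   | inj₁ refl = here refl
      ...   | inj₂ refl = there (here refl)
      ±1-self-inverse : 1# ∷ - 1# ∷ [] ⊆ filter (fixed? _≟_ _⁻¹) nonzeros
      ±1-self-inverse (here refl) =
        ∈-filter⁺ _ (∈-nonzeros 1≢0) (⁻¹-unique 1≢0 (solve 0 (con 1ℤ :* con 1ℤ := con 1ℤ) refl))
      ±1-self-inverse (there (here refl)) =
        ∈-filter⁺ _ (∈-nonzeros -1≢0) (⁻¹-unique -1≢0 (solve 0 ((:- con 1ℤ) :* (:- con 1ℤ) := con 1ℤ) refl))

  record InjectsIntoUnits {S : Set} (D : List S) (f : S → Carrier) : Set where
    field
      nonzero : ∀ {k} → k ∈ D → f k ≢ 0#
      injective : ∀ {k l} → k ∈ D → l ∈ D → f k ≡ f l → k ≡ l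

  module _ {S : Set} {D : List S} (D-unique : Unique D) (∣D∣≡∣nonzeros∣ : length D ≡ length nonzeros) where

    ∏-injectsIntoUnits : ∀ {f} → InjectsIntoUnits D f → ∏ f D ≡ ∏ id nonzeros
    ∏-injectsIntoUnits {f} f-inj = begin
      ∏ f D            ≡⟨ ≡.cong (foldr _*_ 1#) (map-id (map f D)) ⟨
      ∏ id (map f D)   ≡⟨ foldMap-↭ id (⊆∧⊇⇒↭ image-unique nonzeros-unique image⊆nonzeros
                                          (⊆∧length-≤⇒⊇ image-unique image⊆nonzeros ∣nonzeros∣≤∣image∣)) ⟩
      ∏ id nonzeros    ∎
      where
      open InjectsIntoUnits f-inj
      image-unique : Unique (map f D)
      image-unique = Unique-map⁺-injectiveOn D-unique injective
      image⊆nonzeros : map f D ⊆ nonzeros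
      image⊆nonzeros z∈ with ∈-map⁻ f z∈
      ... | k , k∈D , refl = ∈-nonzeros (nonzero k∈D)
      ∣nonzeros∣≤∣image∣ : length nonzeros ≤ length (map f D)
      ∣nonzeros∣≤∣image∣ = ℕ.≤-reflexive (≡.trans (≡.sym ∣D∣≡∣nonzeros∣) (≡.sym (length-map f D)))

    ¬injection≡product-of-injections : 1# + 1# ≢ 0# → ∀ {t ρ s} →
                                       InjectsIntoUnits D t → InjectsIntoUnits D ρ → InjectsIntoUnits D s →
                                       ¬ (∀ {k} → k ∈ D → t k ≡ ρ k * s k)
    ¬injection≡product-of-injections 1+1≢0 {t} {ρ} {s} t-inj ρ-inj s-inj t≡ρs = 1+1≢0 (begin
      1# + 1#          ≡⟨ ≡.cong (1# +_) -1≡1 ⟨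
      1# - 1#          ≡⟨ x-x≡0 1# ⟩
      0#               ∎)
      where
      -1≡1 : - 1# ≡ 1#
      -1≡1 = begin
        - 1#                        ≡⟨ wilson 1+1≢0 ⟨
        ∏ id nonzeros               ≡⟨ ∏-injectsIntoUnits t-inj ⟨
        ∏ t D                       ≡⟨ foldMap-∙ t ρ s D t≡ρs ⟩
        ∏ ρ D * ∏ s D               ≡⟨ ≡.cong₂ _*_ (∏-injectsIntoUnits ρ-inj) (∏-injectsIntoUnits s-inj) ⟩
        ∏ id nonzeros * ∏ id nonzeros ≡⟨ ≡.cong₂ _*_ (wilson 1+1≢0) (wilson 1+1≢0) ⟩
        - 1# * - 1#                 ≡⟨ solve 0 ((:- con 1ℤ) :* (:- con 1ℤ) := con 1ℤ) refl ⟩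
        1#                          ∎

module Geometry {q : ℕ} (F : FiniteField q) where
  open import Data.Nat using (_≤_)
  open FiniteField F hiding (_∈_)
  open FieldProperties F
  open Units F
  open IsCommutativeRing isCommutativeRing using (*-identityˡ)
  open ≡-Reasoning

  _≟ₛ_ : DecidableEquality Slope
  _≟ₛ_ = Maybe.≡-dec _≟_

  ∈-slopes : ∀ i → i ∈ slopes
  ∈-slopes nothing = here refl
  ∈-slopes (just x) = there (∈-map⁺ just (∈-elements x))

  slopes-unique : Unique slopes
  slopes-unique = All.map⁺ (All.tabulate λ _ ()) ∷ Unique.map⁺ Maybe.just-injective elements-unique

  ∈-points : ∀ P → P ∈ points
  ∈-points (x , y) = ∈-concatMap⁺ _ (lose (∈-elements x) (∈-map⁺ (x ,_) (∈-elements y)))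

  length-slopes : length slopes ≡ suc q
  length-slopes = ≡.cong suc (≡.trans (length-map just elements) length-elements)

  -- Junk when the two slopes coincide.
  meet : Slope × Carrier → Slope × Carrier → Point
  meet (nothing , a) (nothing , _) = a , 0#
  meet (nothing , a) (just κ , e) = a , κ * a + e
  meet (just α , c) (nothing , a) = a , α * a + c
  meet (just α , c) (just κ , e) = x , α * x + c
    where x = (e - c) * (α - κ) ⁻¹

  coord : Slope → Point → Carrier
  coord nothing (_ , y) = y
  coord (just _) (x , _) = x

  meet-∈ˡ : ∀ l m → meet l m ∈ℓ l
  meet-∈ˡ (nothing , a) (nothing , _) = refl
  meet-∈ˡ (nothing , a) (just κ , e) = refl
  meet-∈ˡ (just α , c) (nothing , a) = refl
  meet-∈ˡ (just α , c) (just κ , e) = refl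

  meet-abscissa : ∀ {α κ} c e → α ≢ κ → (α - κ) * proj₁ (meet (just α , c) (just κ , e)) ≡ e - c
  meet-abscissa c e α≢κ = ⁻¹-cancelʳ (e - c) (x≢y⇒x-y≢0 α≢κ)

  meet-∈ʳ : ∀ {i k} c e → i ≢ k → meet (i , c) (k , e) ∈ℓ (k , e)
  meet-∈ʳ {nothing} {nothing} _ _ i≢k = ⊥-elim (i≢k refl)
  meet-∈ʳ {nothing} {just κ} _ _ _ = refl
  meet-∈ʳ {just α} {nothing} _ _ _ = refl
  meet-∈ʳ {just α} {just κ} c e α≢κ = x-y≡0⇒x≡y (begin
    (α * x + c) - (κ * x + e)     ≡⟨ solve 5 (λ α κ x c e → (α :* x :+ c) :- (κ :* x :+ e) := (α :- κ) :* x :- (e :- c))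
                                           refl α κ x c e ⟩
    (α - κ) * x - (e - c)         ≡⟨ ≡.cong (_- (e - c)) (meet-abscissa c e (α≢κ ∘ ≡.cong just)) ⟩
    (e - c) - (e - c)             ≡⟨ x-x≡0 (e - c) ⟩
    0#                            ∎)
    where x = proj₁ (meet (just α , c) (just κ , e))

  coord-injective : ∀ {l P Q} → P ∈ℓ l → Q ∈ℓ l → coord (proj₁ l) P ≡ coord (proj₁ l) Q → P ≡ Q
  coord-injective {nothing , _} refl refl refl = refl
  coord-injective {just _ , _} refl refl refl = refl

  -- xA, xB and z are the abscissae of the pairwise intersections of y = αx + c, y = βx + d and y = κx + e.
  similar-triangles : ∀ {α β κ c d e xA xB z} → (α - κ) * xA ≡ e - c → (β - κ) * xB ≡ e - d → (α - β) * z ≡ d - c →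
                      (α - κ) * (xA - z) ≡ (β - κ) * (xB - z)
  similar-triangles {α} {β} {κ} {c} {d} {e} {xA} {xB} {z} hA hB hZ = x-y≡0⇒x≡y (begin
    (α - κ) * (xA - z) - (β - κ) * (xB - z)       ≡⟨ solve 6 (λ α β κ xA xB z → (α :- κ) :* (xA :- z) :- (β :- κ) :* (xB :- z)
                                                       := ((α :- κ) :* xA :- (β :- κ) :* xB) :- (α :- β) :* z) refl α β κ xA xB z ⟩
    ((α - κ) * xA - (β - κ) * xB) - (α - β) * z   ≡⟨ ≡.cong₂ _-_ (≡.cong₂ _-_ hA hB) hZ ⟩
    ((e - c) - (e - d)) - (d - c)                 ≡⟨ solve 3 (λ c d e → ((e :- c) :- (e :- d)) :- (d :- c) := con 0ℤ) refl c d e ⟩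
    0#                                            ∎)

  -- Junk when k = i.
  ratio : Slope → Carrier → Slope → Carrier
  ratio (just α) β (just κ) = möbius α β κ
  ratio (just α) β nothing = 1#
  ratio nothing β (just κ) = β - κ
  ratio nothing β nothing = 1#

  ratio-injectsIntoUnits : ∀ {i β D} → i ≢ just β → (∀ {k} → k ∈ D → i ≢ k × just β ≢ k) → InjectsIntoUnits D (ratio i β)
  ratio-injectsIntoUnits {nothing} {β} {D} _ avoids = record
    { nonzero = ratio≢0
    ; injective = ratio-injective
    }
    where
    ratio≢0 : ∀ {k} → k ∈ D → ratio nothing β k ≢ 0#
    ratio≢0 {nothing} k∈D = ⊥-elim (proj₁ (avoids k∈D) refl)
    ratio≢0 {just κ} κ∈D = x≢y⇒x-y≢0 (proj₂ (avoids κ∈D) ∘ ≡.cong just)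

    ratio-injective : ∀ {k l} → k ∈ D → l ∈ D → ratio nothing β k ≡ ratio nothing β l → k ≡ l
    ratio-injective {nothing} k∈D _ _ = ⊥-elim (proj₁ (avoids k∈D) refl)
    ratio-injective {just _} {nothing} _ l∈D _ = ⊥-elim (proj₁ (avoids l∈D) refl)
    ratio-injective {just κ} {just μ} _ _ β-κ≡β-μ = ≡.cong just (z-x≡z-y⇒x≡y β-κ≡β-μ)
  ratio-injectsIntoUnits {just α} {β} {D} α≢β avoids = record
    { nonzero = ratio≢0
    ; injective = ratio-injective
    }
    where
    α≢ : ∀ {κ} → just κ ∈ D → α ≢ κ
    α≢ κ∈D = proj₁ (avoids κ∈D) ∘ ≡.cong just

    ratio≢0 : ∀ {k} → k ∈ D → ratio (just α) β k ≢ 0#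
    ratio≢0 {nothing} _ = 1≢0
    ratio≢0 {just κ} κ∈D = möbius≢0 (α≢ κ∈D) (proj₂ (avoids κ∈D) ∘ ≡.cong just)

    ratio-injective : ∀ {k l} → k ∈ D → l ∈ D → ratio (just α) β k ≡ ratio (just α) β l → k ≡ l
    ratio-injective {nothing} {nothing} _ _ _ = refl
    ratio-injective {nothing} {just μ} _ μ∈D 1≡möbius = ⊥-elim (möbius≢1 (α≢β ∘ ≡.cong just) (α≢ μ∈D) (≡.sym 1≡möbius))
    ratio-injective {just κ} {nothing} κ∈D _ möbius≡1 = ⊥-elim (möbius≢1 (α≢β ∘ ≡.cong just) (α≢ κ∈D) möbius≡1)
    ratio-injective {just κ} {just μ} κ∈D μ∈D möbius≡ = ≡.cong just (möbius-injective (α≢β ∘ ≡.cong just) (α≢ κ∈D) (α≢ μ∈D) möbius≡)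

  module Configuration (b : Slope → Carrier) where
    open UniqueLists _≟ₛ_

    L : Slope → Slope × Carrier
    L i = i , b i

    Rich : Point → Set
    Rich P = 3 ≤ mult b P

    RichFree : Slope → Set
    RichFree i = ∀ {P} → P ∈ℓ L i → ¬ Rich P

    rich-if-concurrent : ∀ {P i j k} → P ∈ℓ L i → P ∈ℓ L j → P ∈ℓ L k → i ≢ j → i ≢ k → j ≢ k → Rich P
    rich-if-concurrent {P} {i} {j} {k} P∈i P∈j P∈k i≢j i≢k j≢k =
      ⊆⇒length-≤ ((i≢j ∷ i≢k ∷ []) ∷ (j≢k ∷ []) ∷ [] ∷ []) λ
        { (here refl) → ∈-filter⁺ (λ i → P ∈ℓ? L i) (∈-slopes i) P∈i
        ; (there (here refl)) → ∈-filter⁺ (λ i → P ∈ℓ? L i) (∈-slopes j) P∈j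
        ; (there (there (here refl))) → ∈-filter⁺ (λ i → P ∈ℓ? L i) (∈-slopes k) P∈k }

    offset : Slope → Point → Slope → Carrier
    offset i Z k = coord i (meet (L i) (L k)) - coord i Z

    offset-injectsIntoUnits : ∀ {i j Z D} → RichFree i → i ≢ j → Z ∈ℓ L i → Z ∈ℓ L j →
                              (∀ {k} → k ∈ D → i ≢ k × j ≢ k) → InjectsIntoUnits D (offset i Z)
    offset-injectsIntoUnits {i} {j} {Z} {D} i-free i≢j Z∈i Z∈j avoids = record
      { nonzero = offset≢0
      ; injective = offset-injective
      }
      where
      A∈i : ∀ k → meet (L i) (L k) ∈ℓ L i
      A∈i k = meet-∈ˡ (L i) (L k)
      A∈k : ∀ {k} → k ∈ D → meet (L i) (L k) ∈ℓ L k
      A∈k k∈D = meet-∈ʳ _ _ (proj₁ (avoids k∈D))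

      offset≢0 : ∀ {k} → k ∈ D → offset i Z k ≢ 0#
      offset≢0 {k} k∈D offset≡0 =
        i-free Z∈i (rich-if-concurrent Z∈i Z∈j Z∈k i≢j (proj₁ (avoids k∈D)) (proj₂ (avoids k∈D)))
        where
        Z∈k : Z ∈ℓ L k
        Z∈k = subst (_∈ℓ L k) (coord-injective (A∈i k) Z∈i (x-y≡0⇒x≡y offset≡0)) (A∈k k∈D)

      offset-injective : ∀ {k l} → k ∈ D → l ∈ D → offset i Z k ≡ offset i Z l → k ≡ l
      offset-injective {k} {l} k∈D l∈D offsets≡ = decidable-stable (k ≟ₛ l) λ k≢l →
        i-free (A∈i k) (rich-if-concurrent (A∈i k) (A∈k k∈D) A∈l (proj₁ (avoids k∈D)) (proj₁ (avoids l∈D)) k≢l)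
        where
        A∈l : meet (L i) (L k) ∈ℓ L l
        A∈l = subst (_∈ℓ L l) (≡.sym (coord-injective (A∈i k) (A∈i l) (x-z≡y-z⇒x≡y offsets≡))) (A∈k l∈D)

    offset-ratio : ∀ {i β k} → i ≢ just β → i ≢ k → just β ≢ k →
                   let Z = meet (L i) (L (just β)) in offset i Z k ≡ ratio i β k * offset (just β) Z k
    offset-ratio {nothing} {β} {nothing} _ i≢k _ = ⊥-elim (i≢k refl)
    offset-ratio {nothing} {β} {just κ} _ _ β≢κ = begin
      (κ * x₀ + e) - (β * x₀ + d)     ≡⟨ solve 5 (λ x₀ β κ d e → (κ :* x₀ :+ e) :- (β :* x₀ :+ d) := (e :- d) :- (β :- κ) :* x₀)
                                             refl x₀ β κ d e ⟩
      (e - d) - (β - κ) * x₀          ≡⟨ ≡.cong (_- (β - κ) * x₀) (meet-abscissa d e (β≢κ ∘ ≡.cong just)) ⟨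
      (β - κ) * xB - (β - κ) * x₀     ≡⟨ solve 3 (λ u x x₀ → u :* x :- u :* x₀ := u :* (x :- x₀)) refl (β - κ) xB x₀ ⟩
      (β - κ) * (xB - x₀)             ∎
      where
      x₀ = b nothing
      d = b (just β)
      e = b (just κ)
      xB = proj₁ (meet (L (just β)) (L (just κ)))
    offset-ratio {just α} {β} {nothing} _ _ _ = ≡.sym (*-identityˡ _)
    offset-ratio {just α} {β} {just κ} α≢β α≢κ β≢κ =
      ux≡vy⇒x≡vu⁻¹y (x≢y⇒x-y≢0 (α≢κ ∘ ≡.cong just)) (similar-triangles
        (meet-abscissa (b (just α)) (b (just κ)) (α≢κ ∘ ≡.cong just))
        (meet-abscissa (b (just β)) (b (just κ)) (β≢κ ∘ ≡.cong just))
        (meet-abscissa (b (just α)) (b (just β)) (α≢β ∘ ≡.cong just)))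

    others : Slope → Slope → List Slope
    others i j = delete j (delete i slopes)

    others-unique : ∀ {i j} → Unique (others i j)
    others-unique {i} {j} = Unique-delete {j} (Unique-delete {i} slopes-unique)

    ∈-others⁻ : ∀ {i j k} → k ∈ others i j → i ≢ k × j ≢ k
    ∈-others⁻ {i} {j} k∈ =
      let k∈-i , k≢j = ∈-delete⁻ (delete i slopes) k∈
      in (proj₂ (∈-delete⁻ slopes k∈-i) ∘ ≡.sym) , (k≢j ∘ ≡.sym)

    length-others : ∀ {i j} → i ≢ j → length (others i j) ≡ length nonzeros
    length-others {i} {j} i≢j = ℕ.suc-injective (ℕ.suc-injective (begin
      suc (suc (length (others i j)))    ≡⟨ ≡.cong suc (length-delete (Unique-delete {i} slopes-unique)
                                                                       (∈-delete⁺ (∈-slopes j) (i≢j ∘ ≡.sym))) ⟨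
      suc (length (delete i slopes))     ≡⟨ length-delete slopes-unique (∈-slopes i) ⟨
      length slopes                      ≡⟨ length-slopes ⟩
      suc q                              ≡⟨ ≡.cong suc length-nonzeros ⟨
      suc (suc (length nonzeros))        ∎))

    private
      ¬rich-free-pair : 1# + 1# ≢ 0# → ∀ {i β} → i ≢ just β → RichFree i → RichFree (just β) → ⊥
      ¬rich-free-pair 1+1≢0 {i} {β} i≢β i-free β-free =
        ¬injection≡product-of-injections (others-unique {i} {just β}) (length-others i≢β) 1+1≢0
          (offset-injectsIntoUnits i-free i≢β Z∈i Z∈β avoids)
          (ratio-injectsIntoUnits i≢β avoids)
          (offset-injectsIntoUnits β-free (i≢β ∘ ≡.sym) Z∈β Z∈i (swap ∘ avoids))
          (λ k∈ → offset-ratio i≢β (proj₁ (avoids k∈)) (proj₂ (avoids k∈)))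
        where
        avoids : ∀ {k} → k ∈ others i (just β) → i ≢ k × just β ≢ k
        avoids = ∈-others⁻ {i} {just β}
        Z∈i : meet (L i) (L (just β)) ∈ℓ L i
        Z∈i = meet-∈ˡ (L i) (L (just β))
        Z∈β : meet (L i) (L (just β)) ∈ℓ L (just β)
        Z∈β = meet-∈ʳ _ _ i≢β

    ¬two-rich-free-lines : 1# + 1# ≢ 0# → ∀ {i j} → i ≢ j → RichFree i → RichFree j → ⊥
    ¬two-rich-free-lines _ {nothing} {nothing} i≢j = ⊥-elim (i≢j refl)
    ¬two-rich-free-lines 1+1≢0 {just _} {nothing} i≢j i-free j-free = ¬rich-free-pair 1+1≢0 (i≢j ∘ ≡.sym) j-free i-free
    ¬two-rich-free-lines 1+1≢0 {i} {just β} = ¬rich-free-pair 1+1≢0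

module Counting {q : ℕ} (F : FiniteField q) (b : FiniteField.Slope F → FiniteField.Carrier F) where
  open import Data.Nat using (_≤_; _<_)
  open FiniteField F hiding (_∈_)
  open Geometry F
  open Configuration b
  open Sums

  rich? : ∀ P → Dec (Rich P)
  rich? P = 3 ℕ.≤? mult b P

  richIncidence : Point → Slope → ℕ
  richIncidence P i = indicator (rich? P) ℕ.* indicator (P ∈ℓ? L i)

  ∑-richIncidence : ∀ P → ∑ (richIncidence P) slopes ≡ richWeight (mult b P)
  ∑-richIncidence P = ≡.trans (∑-*ˡ (indicator (rich? P)) _ slopes)
                              (≡.cong (indicator (rich? P) ℕ.*_) (∑-indicator (λ i → P ∈ℓ? L i) slopes))

  richIncidence≡1 : ∀ {P i} → Rich P → P ∈ℓ L i → richIncidence P i ≡ 1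
  richIncidence≡1 {P} {i} P-rich P∈i with rich? P | P ∈ℓ? L i
  ... | yes _ | yes _ = refl
  ... | no ¬rich | _ = ⊥-elim (¬rich P-rich)
  ... | yes _ | no P∉i = ⊥-elim (P∉i P∈i)

  richIncidencesOn : Slope → ℕ
  richIncidencesOn i = ∑ (λ P → richIncidence P i) points

  rich-free-if-no-rich-incidence : ∀ {i} → richIncidencesOn i ≡ 0 → RichFree i
  rich-free-if-no-rich-incidence {i} none {P} P∈i P-rich = ℕ.<⇒≢ 0<incidences (≡.sym none)
    where
    0<incidences : 0 < richIncidencesOn i
    0<incidences = subst (_≤ richIncidencesOn i) (richIncidence≡1 P-rich P∈i)
                         (term≤∑ (λ P → richIncidence P i) (∈-points P))

  q≤∑richWeight : ∀ {B} → LinesIn B b → 1# + 1# ≢ 0# → q ≤ ∑ (richWeight ∘ mult b) (pointsOf B)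
  q≤∑richWeight {B} lines 1+1≢0 = begin
    q                                            ≤⟨ ℕ.≤-pred (subst (_≤ suc (∑ richIncidencesOn slopes)) length-slopes
                                                      (length≤1+∑ richIncidencesOn slopes-unique at-most-one-rich-free)) ⟩
    ∑ richIncidencesOn slopes                    ≡⟨ foldMap-swap richIncidence points slopes ⟨
    ∑ (λ P → ∑ (richIncidence P) slopes) points  ≡⟨ ≡.cong (foldr ℕ._+_ 0) (map-cong ∑-richIncidence points) ⟩
    ∑ (richWeight ∘ mult b) points               ≡⟨ ∑-filter (λ P → B P Bool.≟ true) weightless-off-B points ⟨
    ∑ (richWeight ∘ mult b) (pointsOf B)         ∎
    where
    open ℕ.≤-Reasoning
    at-most-one-rich-free : ∀ {i j} → i ∈ slopes → j ∈ slopes → richIncidencesOn i ≡ 0 → richIncidencesOn j ≡ 0 → i ≡ j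
    at-most-one-rich-free {i} {j} _ _ none-on-i none-on-j = decidable-stable (i ≟ₛ j) λ i≢j →
      ¬two-rich-free-lines 1+1≢0 i≢j (rich-free-if-no-rich-incidence none-on-i) (rich-free-if-no-rich-incidence none-on-j)
    weightless-off-B : ∀ {P} → B P ≢ true → richWeight (mult b P) ≡ 0
    weightless-off-B {P} P∉B = ≡.cong (richWeight ∘ length)
      (filter-none (λ i → P ∈ℓ? L i) {xs = slopes} (All.tabulate λ {i} _ P∈i → P∉B (lines i P P∈i)))

module RationalBound where
  open import Data.Nat using (_≤_)
  open Sums
  open import Data.Rational as ℚ using (ℚ; _/_)
  import Data.Rational.Properties as ℚ
  open import Data.Rational.Unnormalised as ℚᵘ using (ℚᵘ; mkℚᵘ; *≡*; *≤*)
  import Data.Rational.Unnormalised.Properties as ℚᵘ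
  open import Data.Integer.Solver using () renaming (module +-*-Solver to ℤ-Solver)
  open import Data.Nat.Solver using () renaming (module +-*-Solver to ℕ-Solver)

  -- mkℚᵘ n 2 is n / 3: the denominator is stored minus one.
  third : ℕ → ℚᵘ
  third n = mkℚᵘ (ℤ.+ n) 2

  private
    third-+ : ∀ m n → third (m ℕ.+ n) ℚᵘ.≃ third m ℚᵘ.+ third n
    third-+ m n = *≡* (≡.trans (≡.cong (ℤ._* ℤ.+ 9) (ℤ.pos-+ m n))
      (solve 2 (λ m n → (m :+ n) :* con (ℤ.+ 9) := (m :* con (ℤ.+ 3) :+ n :* con (ℤ.+ 3)) :* con (ℤ.+ 3))
             refl (ℤ.+ m) (ℤ.+ n)))
      where open ℤ-Solver

    third-mono : ∀ {m n} → m ≤ n → third m ℚᵘ.≤ third n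
    third-mono m≤n = *≤* (ℤ.*-monoʳ-≤-nonNeg (ℤ.+ 3) (ℤ.+≤+ m≤n))

    2·richWeight≤3·pairs : ∀ k → richWeight (3 ℕ.+ k) ℕ.* 2 ≤ ((2 ℕ.+ k) ℕ.* (1 ℕ.+ k)) ℕ.* 3
    2·richWeight≤3·pairs k = ℕ.≤-trans (ℕ.m≤m+n _ (7 ℕ.* k ℕ.+ 3 ℕ.* (k ℕ.* k))) (ℕ.≤-reflexive
      (solve 1 (λ k → (con 1 :* (con 3 :+ k)) :* con 2 :+ (con 7 :* k :+ con 3 :* (k :* k))
                      := ((con 2 :+ k) :* (con 1 :+ k)) :* con 3) refl k))
      where open ℕ-Solver

    third-richWeight≤pairTerm : ∀ m → third (richWeight m) ℚᵘ.≤ ℚ.toℚᵘ (pairTerm m)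
    third-richWeight≤pairTerm m = ℚᵘ.≤-respʳ-≃ (ℚᵘ.≃-sym (ℚ.toℚᵘ-fromℚᵘ _)) (bound m)
      where
      bound : ∀ m → third (richWeight m) ℚᵘ.≤ mkℚᵘ ((ℤ.+ m ℤ.- ℤ.+ 1) ℤ.* (ℤ.+ m ℤ.- ℤ.+ 2)) 1
      bound 0 = *≤* (ℤ.+≤+ z≤n)
      bound 1 = *≤* (ℤ.+≤+ z≤n)
      bound 2 = *≤* (ℤ.+≤+ z≤n)
      bound (suc (suc (suc k))) = *≤* (ℤ.+≤+ (2·richWeight≤3·pairs k))

  pairTerm-sum-bound : {A : Set a} (m : A → ℕ) (xs : List A) {n : ℕ} → n ≤ ∑ (richWeight ∘ m) xs →
                       ℤ.+ n / 3 ℚ.≤ sumℚ (map (pairTerm ∘ m) xs)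
  pairTerm-sum-bound m xs {n} n≤∑ = ℚ.toℚᵘ-cancel-≤ (ℚᵘ.≤-respˡ-≃ (ℚᵘ.≃-sym (ℚ.toℚᵘ-fromℚᵘ (third n)))
    (ℚᵘ.≤-trans (third-mono n≤∑) (∑-bound xs)))
    where
    ∑-bound : ∀ xs → third (∑ (richWeight ∘ m) xs) ℚᵘ.≤ ℚ.toℚᵘ (sumℚ (map (pairTerm ∘ m) xs))
    ∑-bound [] = *≤* (ℤ.+≤+ z≤n)
    ∑-bound (x ∷ xs) = ℚᵘ.≤-respˡ-≃ (ℚᵘ.≃-sym (third-+ (richWeight (m x)) _))
      (ℚᵘ.≤-respʳ-≃ (ℚᵘ.≃-sym (ℚ.toℚᵘ-homo-+ (pairTerm (m x)) _))
        (ℚᵘ.+-mono-≤ (third-richWeight≤pairTerm (m x)) (∑-bound xs)))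

open import Data.Nat using (_^_)
open import Data.Nat.Primality using (Prime)
open import Data.Integer using (+_)
open import Data.Rational using (ℚ; _/_; _≤_)
open import Data.Product using (∃₂)

theorem1 : (q : ℕ) → (∃₂ λ p k → Prime p × q ≡ p ^ suc k) → ¬ (2 ∣ q)
    → (F : FiniteField q) → let open FiniteField F in
      (B : Subset) → IsBesicovitch B → (b : Slope → Carrier) → LinesIn B b
      → (+ q / 3) ≤ sumℚ (map (λ P → pairTerm (mult b P)) (pointsOf B))
theorem1 q _ q-odd F B _ b lines =
  RationalBound.pairTerm-sum-bound (mult b) (pointsOf B) (Counting.q≤∑richWeight F b lines (Units.1+1≢0 F q-odd))
  where open FiniteField F
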